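{- Consider the generalized (dependent) LRU stack model in which, for every finite sequence $\zeta$ of past stack depths, the conditional distribution $s_\zeta(i)=\Pr[d_t=i\mid\zeta]$ of the next stack depth is non-increasing in $i$. Then for every trace length $L$, every sequence $\zeta$ of length at most $L$, and all states $y,z$ with $y\le_c z$, we have $J^*_L(\zeta,y)\le J^*_L(\zeta,z)$; and LRU is an optimal eviction policy for any initial buffer content.
   Context: There are $V$ items and a buffer of fixed capacity $C$; the LRU stack lists items in order of most recent access, and an access at stack depth $d$ moves the item at depth $d$ to the top, shifting positions $1,\dots,d-1$ down by one. A state is a vector $x\in\{0,1\}^V$ with $x(j)=1$ iff the item at LRU depth $j$ is in the buffer. A stack depth $d$ with $x(d)=0$ is a miss: the accessed item is brought in and, the buffer being full, a buffered item other than the accessed one is evicted. The trace has length $L$; after a prefix of stack depths $\zeta$ of length $|\zeta|$, the next depth $d$ has distribution $s_\zeta$. $J^*_L(\zeta,x)$ is the minimum, over eviction policies (which may depend on the history and the current access), of the expected number of misses in the remaining $L-|\zeta|$ accesses, given prefix $\zeta$ and current state $x$; it satisfies $J^*_L(\zeta,x)=\mathbb E_d[\min_u\{g(x,d)+J^*_L(\zeta d,f(x,d,u))\}\mid\zeta]$ with $g(x,d)=1$ if $x(d)=0$ and $0$ otherwise, and $f$ the state transition under eviction choice $u$. Critical pair: $y<_c z$ if, as strings, $y=1\nu1\iota0\sigma$ and $z=1\nu0\iota1\sigma$ for arbitrary binary strings $\nu,\iota$ and $\sigma\in 0^*$; $y\le_c z$ means $y=z$ or $y<_c z$. LRU evicts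 the least recently accessed buffered item.
   Formalization: The conditional distributions $s_\zeta(i)$ of the next stack depth take rational values. -}

module Defs where

open import Data.Bool using (Bool; true; false; if_then_else_; not; _∧_)
open import Data.Nat using (ℕ; zero; suc; _∸_; _≡ᵇ_)
open import Data.Fin using (Fin; toℕ)
open import Data.Vec using (Vec; []; _∷_; lookup; _[_]≔_; toList)
open import Data.List using (List; []; _∷_; _++_; _∷ʳ_; map; foldr; filterᵇ; allFin; length; replicate; last)
open import Data.Maybe using (maybe)
open import Data.Product using (Σ; _×_; ∃-syntax)
open import Data.Rational using (ℚ; 0ℚ; 1ℚ; _+_; _*_; _⊓_)
open import Relation.Binary.PropositionalEquality using (_≡_)
open import Relation.Nullary using (¬_)

-- Stack positions: index k : Fin V stands for stack depth toℕ k + 1.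
-- A state is a vector x : Vec Bool V, x[k] = true iff item at depth k+1 is buffered.

count : ∀ {n} → Vec Bool n → ℕ
count []       = 0
count (b ∷ bs) = (if b then 1 else 0) Data.Nat.+ count bs

insertSecond : ∀ {A : Set} {m} → A → Vec A (suc m) → Vec A (suc (suc m))
insertSecond a (b ∷ bs) = b ∷ a ∷ bs

moveToFront : ∀ {A : Set} {n} → Vec A n → Fin n → Vec A n
moveToFront (a ∷ as) Fin.zero    = a ∷ as
moveToFront {n = suc (suc _)} (a ∷ as) (Fin.suc i) = insertSecond a (moveToFront as i)

-- State after access at position i, before any eviction: the accessed item is
-- (brought into the buffer and) moved to the top of the LRU stack.
next : ∀ {V} → Vec Bool V → Fin V → Vec Bool V
next x i = moveToFront (x [ i ]≔ true) i

evict : ∀ {V} → Vec Bool V → Fin V → Vec Bool V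
evict v j = v [ j ]≔ false

-- Admissible evictions in post-access state v: buffered items other than the
-- accessed one (which now sits at position 0).
candidates : ∀ {V} → Vec Bool V → List (Fin V)
candidates {V} v = filterᵇ (λ j → not (toℕ j ≡ᵇ 0) ∧ lookup v j) (allFin V)

Evictable : ∀ {V} → Vec Bool V → Fin V → Set
Evictable v j = ¬ (toℕ j ≡ 0) × lookup v j ≡ true

sumℚ : List ℚ → ℚ
sumℚ = foldr _+_ 0ℚ

-- minimum of a list (value on the empty list is irrelevant: never used on full states with C ≥ 1)
minList : List ℚ → ℚ
minList []           = 0ℚ
minList (q ∷ [])     = q
minList (q ∷ r ∷ qs) = q ⊓ minList (r ∷ qs)

-- Conditional next-depth distributions s ζ i = Pr[d = toℕ i + 1 | ζ]
Dist : ℕ → Set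
Dist V = List (Fin V) → Fin V → ℚ

g : ∀ {V} → Vec Bool V → Fin V → ℚ
g x i = if lookup x i then 0ℚ else 1ℚ

-- Optimal cost-to-go with k accesses remaining (dynamic programming recursion)
Jopt : ∀ {V} → Dist V → ℕ → List (Fin V) → Vec Bool V → ℚ
Jopt s zero    ζ x = 0ℚ
Jopt {V} s (suc k) ζ x =
  sumℚ (map (λ i → s ζ i * (g x i +
     (if lookup x i
        then Jopt s k (ζ ∷ʳ i) (next x i)
        else minList (map (λ j → Jopt s k (ζ ∷ʳ i) (evict (next x i) j))
                          (candidates (next x i))))))
            (allFin V))

Jstar : ∀ {V} → Dist V → ℕ → List (Fin V) → Vec Bool V → ℚ
Jstar s L ζ x = Jopt s (L ∸ length ζ) ζ x

-- Eviction policies: given history ζ, current state x, and current access i,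
-- choose which position (of next x i) to evict on a miss.
Policy : ℕ → Set
Policy V = List (Fin V) → Vec Bool V → Fin V → Fin V

ValidPolicy : ∀ {V} → ℕ → Policy V → Set
ValidPolicy {V} C π = ∀ (ζ : List (Fin V)) (x : Vec Bool V) → count x ≡ C →
  ∀ i → lookup x i ≡ false → Evictable (next x i) (π ζ x i)

Jpol' : ∀ {V} → Dist V → Policy V → ℕ → List (Fin V) → Vec Bool V → ℚ
Jpol' s π zero    ζ x = 0ℚ
Jpol' {V} s π (suc k) ζ x =
  sumℚ (map (λ i → s ζ i * (g x i +
     (if lookup x i
        then Jpol' s π k (ζ ∷ʳ i) (next x i)
        else Jpol' s π k (ζ ∷ʳ i) (evict (next x i) (π ζ x i)))))
            (allFin V))

Jpol : ∀ {V} → Dist V → Policy V → ℕ → List (Fin V) → Vec Bool V → ℚ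
Jpol s π L ζ x = Jpol' s π (L ∸ length ζ) ζ x

LRU : ∀ {V} → Policy V
LRU ζ x i = maybe (λ j → j) i (last (candidates (next x i)))

_<c_ : ∀ {V} → Vec Bool V → Vec Bool V → Set
y <c z = ∃[ ν ] ∃[ ι ] ∃[ m ]
  (toList y ≡ true ∷ ν ++ true ∷ ι ++ false ∷ replicate m false)
  × (toList z ≡ true ∷ ν ++ false ∷ ι ++ true ∷ replicate m false)

open import Data.Sum using (_⊎_)
_≤c_ : ∀ {V} → Vec Bool V → Vec Bool V → Set
y ≤c z = y ≡ z ⊎ y <c z

-- After an
-- access where y and z agree, the next states, and the best evictions from them, are again related by a
-- critical pair or coincide. At the upper position where they differ y hits while z misses, leaving a tail
-- pair (y lacks only the deepest buffered item of z); at the lower position z hits while y misses and can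
-- evict down to z's state. So y saves a miss at the upper position and pays at most one at the lower one,
-- which is accessed no more often. Evicting the deepest buffered item yields a state ≤c every other eviction
-- outcome, so LRU attains the minimum in the Bellman equation: its cost is J*, a lower bound for every valid
-- policy.

module Submission where

open import Defs
open import Algebra.Bundles using (CommutativeMonoid)
open import Algebra.Properties.CommutativeSemigroup using (interchange)
open import Data.Bool using (Bool; true; false; if_then_else_; T; not; _∧_)
open import Data.Bool.Properties using (T-≡)
open import Data.Fin using (Fin; zero; suc; toℕ; _≟_; punchOut)
open import Data.List using (List; []; _∷_; map; allFin; length; _++_; replicate; last; tabulate; filterᵇ; _∷ʳ_)
open import Data.List.Membership.Propositional using (_∈_)
open import Data.List.Membership.Propositional.Properties using (∈-filter⁺; ∈-filter⁻; ∈-allFin)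
open import Data.List.Properties using (map-∘; map-cong; map-tabulate; filter-accept; filter-reject; ∷-injective; last-map)
open import Data.List.Relation.Unary.Any using (here; there)
open import Data.Maybe using (just; maybe)
import Data.Maybe as Maybe
open import Data.Nat using (ℕ; zero; suc; _≤_; _<_; _∸_; s≤s; z≤n; _≡ᵇ_) renaming (_+_ to _+ℕ_)
open import Data.Nat.Properties using (<⇒≤; <-irrefl; suc-injective; +-suc)
open import Data.Product using (∃; ∃-syntax; _×_; _,_; proj₁; proj₂)
open import Data.Rational using (ℚ; 0ℚ; 1ℚ; _+_; _*_; -_; nonNegative) renaming (_≤_ to _≤ℚ_)
open import Data.Rational.Properties
  using (≤-refl; ≤-trans; ≤-antisym; ≤-reflexive; +-mono-≤; +-monoˡ-≤; +-monoʳ-≤; +-identityˡ; +-identityʳ;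
         +-assoc; +-inverseʳ; *-monoˡ-≤-nonNeg; p⊓q≤p; p⊓q≤q; ⊓-glb; +-0-commutativeMonoid; module ≤-Reasoning)
open import Data.Rational.Solver using (module +-*-Solver)
open import Data.Sum using (_⊎_; inj₁; inj₂)
open import Data.Vec using (Vec; []; _∷_; lookup; _[_]≔_; removeAt; toList)
open import Data.Vec.Properties using (removeAt-punchOut)
open import Function using (_∘_; id; Equivalence)
open import Relation.Binary.PropositionalEquality
  using (_≡_; _≢_; refl; sym; trans; cong; subst; subst₂; module ≡-Reasoning)
open import Relation.Nullary using (yes; no; contradiction)
open import Relation.Nullary.Decidable using (T?)

private variable
  n : ℕ
  b : Bool

-- With σ ∈ 0*: TailPair y z means y = ι0σ, z = ι1σ, and CriticalPair y z means y = ν1ι0σ, z = ν0ι1σ.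

data AllFalse : Vec Bool n → Set where
  []     : AllFalse []
  false∷ : {σ : Vec Bool n} → AllFalse σ → AllFalse (false ∷ σ)

data TailPair : Vec Bool n → Vec Bool n → Set where
  here  : {σ : Vec Bool n} → AllFalse σ → TailPair (false ∷ σ) (true ∷ σ)
  there : {y z : Vec Bool n} → TailPair y z → TailPair (b ∷ y) (b ∷ z)

data CriticalPair : Vec Bool n → Vec Bool n → Set where
  here  : {y z : Vec Bool n} → TailPair y z → CriticalPair (true ∷ y) (false ∷ z)
  there : {y z : Vec Bool n} → CriticalPair y z → CriticalPair (b ∷ y) (b ∷ z)

data Deepest : Vec Bool n → Fin n → Set where
  here  : {σ : Vec Bool n} → AllFalse σ → Deepest (true ∷ σ) zero
  there : {R : Vec Bool n} {l : Fin n} → Deepest R l → Deepest (b ∷ R) (suc l)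

added : {y z : Vec Bool n} → TailPair y z → Fin n
added (here _)  = zero
added (there t) = suc (added t)

upper lower : {y z : Vec Bool n} → CriticalPair y z → Fin n
upper (here _)  = zero
upper (there c) = suc (upper c)
lower (here t)  = suc (added t)
lower (there c) = suc (lower c)

upper<lower : {y z : Vec Bool n} (c : CriticalPair y z) → toℕ (upper c) < toℕ (lower c)
upper<lower (here _)  = s≤s z≤n
upper<lower (there c) = s≤s (upper<lower c)

AllFalse-lookup : {σ : Vec Bool n} → AllFalse σ → ∀ j → lookup σ j ≡ false
AllFalse-lookup (false∷ f) zero    = refl
AllFalse-lookup (false∷ f) (suc j) = AllFalse-lookup f j

AllFalse-unique : {σ τ : Vec Bool n} → AllFalse σ → AllFalse τ → σ ≡ τ
AllFalse-unique []         []         = refl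
AllFalse-unique (false∷ f) (false∷ g) = cong (false ∷_) (AllFalse-unique f g)

AllFalse-removeAt : {σ : Vec Bool (suc n)} → AllFalse σ → ∀ i → AllFalse (removeAt σ i)
AllFalse-removeAt (false∷ f)          zero    = f
AllFalse-removeAt (false∷ (false∷ f)) (suc i) = false∷ (AllFalse-removeAt (false∷ f) i)

TailPair-added : {y z : Vec Bool n} (t : TailPair y z) → lookup y (added t) ≡ false × lookup z (added t) ≡ true
TailPair-added (here _)  = refl , refl
TailPair-added (there t) = TailPair-added t

TailPair-agree : {y z : Vec Bool n} (t : TailPair y z) {i : Fin n} → i ≢ added t → lookup y i ≡ lookup z i
TailPair-agree (here _)  {zero}  i≢ = contradiction refl i≢
TailPair-agree (here _)  {suc i} i≢ = refl
TailPair-agree (there t) {zero}  i≢ = refl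
TailPair-agree (there t) {suc i} i≢ = TailPair-agree t (i≢ ∘ cong suc)

CriticalPair-upper : {y z : Vec Bool n} (c : CriticalPair y z) → lookup y (upper c) ≡ true × lookup z (upper c) ≡ false
CriticalPair-upper (here _)  = refl , refl
CriticalPair-upper (there c) = CriticalPair-upper c

CriticalPair-lower : {y z : Vec Bool n} (c : CriticalPair y z) → lookup y (lower c) ≡ false × lookup z (lower c) ≡ true
CriticalPair-lower (here t)  = TailPair-added t
CriticalPair-lower (there c) = CriticalPair-lower c

CriticalPair-agree : {y z : Vec Bool n} (c : CriticalPair y z) {i : Fin n} →
                     i ≢ upper c → i ≢ lower c → lookup y i ≡ lookup z i
CriticalPair-agree (here t)  {zero}  i≢u i≢l = contradiction refl i≢u
CriticalPair-agree (here t)  {suc i} i≢u i≢l = TailPair-agree t (i≢l ∘ cong suc)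
CriticalPair-agree (there c) {zero}  i≢u i≢l = refl
CriticalPair-agree (there c) {suc i} i≢u i≢l = CriticalPair-agree c (i≢u ∘ cong suc) (i≢l ∘ cong suc)

moveToFront-≔ : ∀ {A : Set} (x : Vec A (suc n)) i (a : A) → moveToFront (x [ i ]≔ a) i ≡ a ∷ removeAt x i
moveToFront-≔ (_ ∷ _)        zero    a = refl
moveToFront-≔ (a′ ∷ x@(_ ∷ _)) (suc i) a = cong (insertSecond a′) (moveToFront-≔ x i a)

next≡ : ∀ (x : Vec Bool (suc n)) i → next x i ≡ true ∷ removeAt x i
next≡ x i = moveToFront-≔ x i true

TailPair-removeAt : {y z : Vec Bool (suc n)} → TailPair y z → ∀ i → lookup y i ≡ lookup z i →
                    TailPair (removeAt y i) (removeAt z i)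
TailPair-removeAt (here _)                zero    ()
TailPair-removeAt (here (false∷ f))       (suc i) _ = here (AllFalse-removeAt (false∷ f) i)
TailPair-removeAt (there t)               zero    _ = t
TailPair-removeAt (there t@(here _))      (suc i) e = there (TailPair-removeAt t i e)
TailPair-removeAt (there t@(there _))     (suc i) e = there (TailPair-removeAt t i e)

TailPair-removeAt-added : {y z : Vec Bool (suc n)} (t : TailPair y z) → removeAt y (added t) ≡ removeAt z (added t)
TailPair-removeAt-added (here _)             = refl
TailPair-removeAt-added (there t@(here _))   = cong (_ ∷_) (TailPair-removeAt-added t)
TailPair-removeAt-added (there t@(there _))  = cong (_ ∷_) (TailPair-removeAt-added t)

CriticalPair-removeAt : {y z : Vec Bool (suc n)} → CriticalPair y z → ∀ i → lookup y i ≡ lookup z i →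
                        CriticalPair (removeAt y i) (removeAt z i)
CriticalPair-removeAt (here _)              zero    ()
CriticalPair-removeAt (here t@(here _))     (suc i) e = here (TailPair-removeAt t i e)
CriticalPair-removeAt (here t@(there _))    (suc i) e = here (TailPair-removeAt t i e)
CriticalPair-removeAt (there c)             zero    _ = c
CriticalPair-removeAt (there c@(here _))    (suc i) e = there (CriticalPair-removeAt c i e)
CriticalPair-removeAt (there c@(there _))   (suc i) e = there (CriticalPair-removeAt c i e)

CriticalPair-removeAt-upper : {y z : Vec Bool (suc n)} (c : CriticalPair y z) →
                              TailPair (removeAt y (upper c)) (removeAt z (upper c))
CriticalPair-removeAt-upper (here t)            = t
CriticalPair-removeAt-upper (there c@(here _))  = there (CriticalPair-removeAt-upper c)
CriticalPair-removeAt-upper (there c@(there _)) = there (CriticalPair-removeAt-upper c)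

CriticalPair-removeAt-lower : {y z : Vec Bool (suc n)} (c : CriticalPair y z) →
                              ∃[ j ] lookup (removeAt y (lower c)) j ≡ true
                                   × removeAt y (lower c) [ j ]≔ false ≡ removeAt z (lower c)
CriticalPair-removeAt-lower (here t@(here _))   = zero , refl , cong (false ∷_) (TailPair-removeAt-added t)
CriticalPair-removeAt-lower (here t@(there _))  = zero , refl , cong (false ∷_) (TailPair-removeAt-added t)
CriticalPair-removeAt-lower (there c@(here _))  =
  let j , hit , eq = CriticalPair-removeAt-lower c in suc j , hit , cong (_ ∷_) eq
CriticalPair-removeAt-lower (there c@(there _)) =
  let j , hit , eq = CriticalPair-removeAt-lower c in suc j , hit , cong (_ ∷_) eq

TailPair-evict : {y z : Vec Bool n} → TailPair y z → ∀ j → lookup z j ≡ true →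
                 z [ j ]≔ false ≡ y ⊎ CriticalPair y (z [ j ]≔ false)
TailPair-evict (here _)  zero    _    = inj₁ refl
TailPair-evict (here f)  (suc j) hit  = contradiction (trans (sym (AllFalse-lookup f j)) hit) λ ()
TailPair-evict (there t) zero    refl = inj₂ (here t)
TailPair-evict (there t) (suc j) hit with TailPair-evict t j hit
... | inj₁ eq = inj₁ (cong (_ ∷_) eq)
... | inj₂ c  = inj₂ (there c)

TailPair-evict-both : {y z : Vec Bool n} → TailPair y z → ∀ j → lookup z j ≡ true →
                      z [ j ]≔ false ≡ y ⊎ (lookup y j ≡ true × TailPair (y [ j ]≔ false) (z [ j ]≔ false))
TailPair-evict-both (here _)  zero    _    = inj₁ refl
TailPair-evict-both (here f)  (suc j) hit  = contradiction (trans (sym (AllFalse-lookup f j)) hit) λ ()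
TailPair-evict-both (there t) zero    refl = inj₂ (refl , there t)
TailPair-evict-both (there t) (suc j) hit with TailPair-evict-both t j hit
... | inj₁ eq         = inj₁ (cong (_ ∷_) eq)
... | inj₂ (hit′ , t′) = inj₂ (hit′ , there t′)

CriticalPair-evict : {y z : Vec Bool n} → CriticalPair y z → ∀ j → lookup z j ≡ true →
                     (∃[ j′ ] lookup y j′ ≡ true × y [ j′ ]≔ false ≡ z [ j ]≔ false)
                     ⊎ (lookup y j ≡ true × CriticalPair (y [ j ]≔ false) (z [ j ]≔ false))
CriticalPair-evict (here t) (suc j) hit with TailPair-evict-both t j hit
... | inj₁ eq          = inj₁ (zero , refl , cong (false ∷_) (sym eq))
... | inj₂ (hit′ , t′) = inj₂ (hit′ , here t′)
CriticalPair-evict (there c) zero    refl = inj₂ (refl , there c)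
CriticalPair-evict (there c) (suc j) hit with CriticalPair-evict c j hit
... | inj₁ (j′ , hit′ , eq) = inj₁ (suc j′ , hit′ , cong (_ ∷_) eq)
... | inj₂ (hit′ , c′)      = inj₂ (hit′ , there c′)

Deepest-lookup : {R : Vec Bool n} {l : Fin n} → Deepest R l → lookup R l ≡ true
Deepest-lookup (here _)  = refl
Deepest-lookup (there d) = Deepest-lookup d

Deepest-TailPair : {R : Vec Bool n} {l : Fin n} → Deepest R l → TailPair (R [ l ]≔ false) R
Deepest-TailPair (here f)  = here f
Deepest-TailPair (there d) = there (Deepest-TailPair d)

deepest? : (R : Vec Bool n) → AllFalse R ⊎ ∃ (Deepest R)
deepest? []      = inj₁ []
deepest? (b ∷ R) with deepest? R
deepest? (_     ∷ R) | inj₂ (l , d) = inj₂ (suc l , there d)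
deepest? (true  ∷ R) | inj₁ f       = inj₂ (zero , here f)
deepest? (false ∷ R) | inj₁ f       = inj₁ (false∷ f)

Deepest-exists : {R : Vec Bool n} {j : Fin n} → lookup R j ≡ true → ∃ (Deepest R)
Deepest-exists {R = R} {j} hit with deepest? R
... | inj₁ f = contradiction (trans (sym (AllFalse-lookup f j)) hit) λ ()
... | inj₂ d = d

AllFalse-fromList : ∀ (σ : Vec Bool n) m → toList σ ≡ replicate m false → AllFalse σ
AllFalse-fromList []      _       _  = []
AllFalse-fromList (b ∷ σ) (suc m) eq with ∷-injective eq
... | refl , eq′ = false∷ (AllFalse-fromList σ m eq′)

TailPair-fromList : ∀ (y z : Vec Bool n) ι m → toList y ≡ ι ++ false ∷ replicate m false →
                    toList z ≡ ι ++ true ∷ replicate m false → TailPair y z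
TailPair-fromList (_ ∷ y) (_ ∷ z) [] m eqʸ eqᶻ with ∷-injective eqʸ | ∷-injective eqᶻ
... | refl , eqʸ′ | refl , eqᶻ′
  with AllFalse-unique (AllFalse-fromList y m eqʸ′) (AllFalse-fromList z m eqᶻ′)
... | refl = here (AllFalse-fromList z m eqᶻ′)
TailPair-fromList (_ ∷ y) (_ ∷ z) (_ ∷ ι) m eqʸ eqᶻ with ∷-injective eqʸ | ∷-injective eqᶻ
... | refl , eqʸ′ | refl , eqᶻ′ = there (TailPair-fromList y z ι m eqʸ′ eqᶻ′)

CriticalPair-fromList : ∀ (y z : Vec Bool n) ν ι m → toList y ≡ ν ++ true ∷ ι ++ false ∷ replicate m false →
                        toList z ≡ ν ++ false ∷ ι ++ true ∷ replicate m false → CriticalPair y z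
CriticalPair-fromList (_ ∷ y) (_ ∷ z) [] ι m eqʸ eqᶻ with ∷-injective eqʸ | ∷-injective eqᶻ
... | refl , eqʸ′ | refl , eqᶻ′ = here (TailPair-fromList y z ι m eqʸ′ eqᶻ′)
CriticalPair-fromList (_ ∷ y) (_ ∷ z) (_ ∷ ν) ι m eqʸ eqᶻ with ∷-injective eqʸ | ∷-injective eqᶻ
... | refl , eqʸ′ | refl , eqᶻ′ = there (CriticalPair-fromList y z ν ι m eqʸ′ eqᶻ′)

<c⇒CriticalPair : {y z : Vec Bool (suc n)} → y <c z →
                  ∃[ a ] ∃[ b ] y ≡ true ∷ a × z ≡ true ∷ b × CriticalPair a b
<c⇒CriticalPair {y = _ ∷ a} {_ ∷ b} (ν , ι , m , eqʸ , eqᶻ) with ∷-injective eqʸ | ∷-injective eqᶻ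
... | refl , eqʸ′ | refl , eqᶻ′ = a , b , refl , refl , CriticalPair-fromList a b ν ι m eqʸ′ eqᶻ′

-- Eviction candidates, the LRU choice and buffer occupancy

buffered : Vec Bool n → List (Fin n)
buffered []          = []
buffered (true ∷ w)  = zero ∷ map suc (buffered w)
buffered (false ∷ w) = map suc (buffered w)

filterᵇ-tabulate : ∀ {m k} (w : Vec Bool m) (h : Fin m → Fin k) (q : Fin k → Bool) →
                   (∀ j → q (h j) ≡ lookup w j) → filterᵇ q (tabulate h) ≡ map h (buffered w)
filterᵇ-tabulate []          h q q∘h≡w = refl
filterᵇ-tabulate (true ∷ w)  h q q∘h≡w =
  trans (filter-accept (T? ∘ q) (subst T (sym (q∘h≡w zero)) _))
        (cong (h zero ∷_) (trans (filterᵇ-tabulate w (h ∘ suc) q (q∘h≡w ∘ suc)) (map-∘ (buffered w))))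
filterᵇ-tabulate (false ∷ w) h q q∘h≡w =
  trans (filter-reject (T? ∘ q) (subst T (q∘h≡w zero)))
        (trans (filterᵇ-tabulate w (h ∘ suc) q (q∘h≡w ∘ suc)) (map-∘ (buffered w)))

candidates-∷ : ∀ (R : Vec Bool n) → candidates (b ∷ R) ≡ map suc (buffered R)
candidates-∷ R = filterᵇ-tabulate R suc _ λ _ → refl

AllFalse-buffered : {σ : Vec Bool n} → AllFalse σ → buffered σ ≡ []
AllFalse-buffered []         = refl
AllFalse-buffered (false∷ f) = cong (map suc) (AllFalse-buffered f)

last-∷ : ∀ {A : Set} (x : A) xs {y} → last xs ≡ just y → last (x ∷ xs) ≡ just y
last-∷ x (_ ∷ _) eq = eq

last-buffered : {R : Vec Bool n} {l : Fin n} → Deepest R l → last (buffered R) ≡ just l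
last-buffered (here f) rewrite AllFalse-buffered f = refl
last-buffered (there {b = true}  {R = R} d) =
  last-∷ zero (map suc (buffered R)) (trans (last-map suc (buffered R)) (cong (Maybe.map suc) (last-buffered d)))
last-buffered (there {b = false} {R = R} d) =
  trans (last-map suc (buffered R)) (cong (Maybe.map suc) (last-buffered d))

LRU-evicts-deepest : ∀ ζ (x : Vec Bool (suc n)) i {l} → Deepest (removeAt x i) l → LRU ζ x i ≡ suc l
LRU-evicts-deepest ζ x i {l} d = begin
  maybe id i (last (candidates (next x i)))                   ≡⟨ cong (maybe id i ∘ last ∘ candidates) (next≡ x i) ⟩
  maybe id i (last (candidates (true ∷ R)))                   ≡⟨ cong (maybe id i ∘ last) (candidates-∷ R) ⟩
  maybe id i (last (map suc (buffered R)))                    ≡⟨ cong (maybe id i) (last-map suc (buffered R)) ⟩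
  maybe id i (Maybe.map suc (last (buffered R)))              ≡⟨ cong (maybe id i ∘ Maybe.map suc) (last-buffered d) ⟩
  suc l                                                       ∎
  where
  R = removeAt x i
  open ≡-Reasoning

isCandidate : Vec Bool n → Fin n → Bool
isCandidate v j = not (toℕ j ≡ᵇ 0) ∧ lookup v j

Evictable⇒∈candidates : ∀ (v : Vec Bool n) {j} → Evictable v j → j ∈ candidates v
Evictable⇒∈candidates v {zero}  (j≢0 , _)  = contradiction refl j≢0
Evictable⇒∈candidates v {suc j} (_ , hit) =
  ∈-filter⁺ (T? ∘ isCandidate v) (∈-allFin (suc j)) (Equivalence.from T-≡ hit)

∈candidates⇒Evictable : ∀ (v : Vec Bool n) {j} → j ∈ candidates v → Evictable v j
∈candidates⇒Evictable v {j} j∈ with ∈-filter⁻ (T? ∘ isCandidate v) {xs = allFin _} j∈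
∈candidates⇒Evictable v {suc j} j∈ | _ , hit = (λ ()) , Equivalence.to T-≡ hit

count-removeAt-hit : ∀ (x : Vec Bool (suc n)) i → lookup x i ≡ true → count x ≡ suc (count (removeAt x i))
count-removeAt-hit (_ ∷ _)            zero    refl = refl
count-removeAt-hit (b ∷ x@(_ ∷ _)) (suc i) hit  =
  trans (cong ((if b then 1 else 0) +ℕ_) (count-removeAt-hit x i hit)) (+-suc _ _)

count-removeAt-miss : ∀ (x : Vec Bool (suc n)) i → lookup x i ≡ false → count x ≡ count (removeAt x i)
count-removeAt-miss (_ ∷ _)            zero    refl = refl
count-removeAt-miss (b ∷ x@(_ ∷ _)) (suc i) miss =
  cong ((if b then 1 else 0) +ℕ_) (count-removeAt-miss x i miss)

count-evict : ∀ (v : Vec Bool n) j → lookup v j ≡ true → count v ≡ suc (count (evict v j))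
count-evict (_ ∷ _) zero    refl = refl
count-evict (b ∷ v) (suc j) hit  = trans (cong ((if b then 1 else 0) +ℕ_) (count-evict v j hit)) (+-suc _ _)

count≡suc⇒buffered : ∀ (x : Vec Bool n) {k} → count x ≡ suc k → ∃[ p ] lookup x p ≡ true
count≡suc⇒buffered (true  ∷ x) _  = zero , refl
count≡suc⇒buffered (false ∷ x) eq = let p , hit = count≡suc⇒buffered x eq in suc p , hit

count-next-hit : ∀ (x : Vec Bool (suc n)) i → lookup x i ≡ true → count (next x i) ≡ count x
count-next-hit x i hit = trans (cong count (next≡ x i)) (sym (count-removeAt-hit x i hit))

count-next-miss : ∀ (x : Vec Bool (suc n)) i → lookup x i ≡ false → count (next x i) ≡ suc (count x)
count-next-miss x i miss = trans (cong count (next≡ x i)) (cong suc (sym (count-removeAt-miss x i miss)))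

removeAt-buffered : ∀ (x : Vec Bool (suc n)) {p i} → lookup x p ≡ true → lookup x i ≡ false →
                    ∃[ q ] lookup (removeAt x i) q ≡ true
removeAt-buffered x {p} {i} hit miss = punchOut i≢p , trans (removeAt-punchOut x i≢p) hit
  where
  i≢p : i ≢ p
  i≢p refl = contradiction (trans (sym hit) miss) λ ()

-- Finite sums and minima of rationals

minList-≤ : ∀ {A : Set} (xs : List A) (f : A → ℚ) {x} → x ∈ xs → minList (map f xs) ≤ℚ f x
minList-≤ (_ ∷ [])     f (here refl) = ≤-refl
minList-≤ (x ∷ _ ∷ _)  f (here refl) = p⊓q≤p (f x) _
minList-≤ (x ∷ y ∷ xs) f (there x∈)  = ≤-trans (p⊓q≤q (f x) _) (minList-≤ (y ∷ xs) f x∈)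

minList-glb : ∀ {A : Set} (xs : List A) (f : A → ℚ) {c x} → x ∈ xs →
              (∀ y → y ∈ xs → c ≤ℚ f y) → c ≤ℚ minList (map f xs)
minList-glb (x ∷ [])     f _ c≤ = c≤ x (here refl)
minList-glb (x ∷ y ∷ xs) f _ c≤ = ⊓-glb (c≤ x (here refl)) (minList-glb (y ∷ xs) f (here refl) (λ z → c≤ z ∘ there))

sumℚ-mono-≤ : ∀ {A : Set} (xs : List A) {f h : A → ℚ} → (∀ x → f x ≤ℚ h x) → sumℚ (map f xs) ≤ℚ sumℚ (map h xs)
sumℚ-mono-≤ []       f≤h = ≤-refl
sumℚ-mono-≤ (x ∷ xs) f≤h = +-mono-≤ (f≤h x) (sumℚ-mono-≤ xs f≤h)

sumℚ-+ : ∀ {A : Set} (xs : List A) (f h : A → ℚ) → sumℚ (map (λ x → f x + h x) xs) ≡ sumℚ (map f xs) + sumℚ (map h xs)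
sumℚ-+ []       f h = sym (+-identityˡ 0ℚ)
sumℚ-+ (x ∷ xs) f h = trans (cong (f x + h x +_) (sumℚ-+ xs f h)) (interchange (CommutativeMonoid.commutativeSemigroup +-0-commutativeMonoid) (f x) (h x) _ _)

pointMass : ∀ {m} → Fin m → ℚ → Fin m → ℚ
pointMass zero    a zero    = a
pointMass zero    a (suc _) = 0ℚ
pointMass (suc A) a zero    = 0ℚ
pointMass (suc A) a (suc i) = pointMass A a i

pointMass-self : ∀ {m} (A : Fin m) a → pointMass A a A ≡ a
pointMass-self zero    a = refl
pointMass-self (suc A) a = pointMass-self A a

pointMass-other : ∀ {m} {A i : Fin m} a → i ≢ A → pointMass A a i ≡ 0ℚ
pointMass-other {A = zero}  {zero}  a i≢A = contradiction refl i≢A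
pointMass-other {A = zero}  {suc i} a i≢A = refl
pointMass-other {A = suc A} {zero}  a i≢A = refl
pointMass-other {A = suc A} {suc i} a i≢A = pointMass-other a (i≢A ∘ cong suc)

sumℚ-allFin-suc : ∀ m (f : Fin (suc m) → ℚ) → sumℚ (map f (allFin (suc m))) ≡ f zero + sumℚ (map (f ∘ suc) (allFin m))
sumℚ-allFin-suc m f = cong (λ xs → f zero + sumℚ xs) (trans (map-tabulate suc f) (sym (map-tabulate id (f ∘ suc))))

sumℚ-zero : ∀ {A : Set} (xs : List A) → sumℚ (map (λ _ → 0ℚ) xs) ≡ 0ℚ
sumℚ-zero []       = refl
sumℚ-zero (_ ∷ xs) = trans (+-identityˡ _) (sumℚ-zero xs)

sumℚ-pointMass : ∀ {m} (A : Fin m) a → sumℚ (map (pointMass A a) (allFin m)) ≡ a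
sumℚ-pointMass {suc m} zero    a =
  trans (sumℚ-allFin-suc m (pointMass zero a)) (trans (cong (a +_) (sumℚ-zero (allFin m))) (+-identityʳ a))
sumℚ-pointMass {suc m} (suc A) a =
  trans (sumℚ-allFin-suc m (pointMass (suc A) a)) (trans (+-identityˡ _) (sumℚ-pointMass A a))

+-cancelʳ-≤ : ∀ p q r → p + r ≤ℚ q + r → p ≤ℚ q
+-cancelʳ-≤ p q r le = subst₂ _≤ℚ_ (cancel p) (cancel q) (+-monoˡ-≤ (- r) le)
  where
  cancel : ∀ x → x + r + - r ≡ x
  cancel x = trans (+-assoc x r (- r)) (trans (cong (x +_) (+-inverseʳ r)) (+-identityʳ x))

sumℚ-exchange : ∀ {m} (f h : Fin m → ℚ) {A B : Fin m} {a b : ℚ} → A ≢ B → b ≤ℚ a →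
                f A + a ≤ℚ h A → f B ≤ℚ h B + b → (∀ i → i ≢ A → i ≢ B → f i ≤ℚ h i) →
                sumℚ (map f (allFin m)) ≤ℚ sumℚ (map h (allFin m))
sumℚ-exchange {m} f h {A} {B} {a} {b} A≢B b≤a at-A at-B elsewhere = +-cancelʳ-≤ Σf Σh a (begin
  Σf + a                                            ≡⟨ sym (sumℚ-with f A a) ⟩
  sumℚ (map (λ i → f i + pointMass A a i) (allFin m)) ≤⟨ sumℚ-mono-≤ (allFin m) pointwise ⟩
  sumℚ (map (λ i → h i + pointMass B b i) (allFin m)) ≡⟨ sumℚ-with h B b ⟩
  Σh + b                                            ≤⟨ +-monoʳ-≤ Σh b≤a ⟩
  Σh + a                                            ∎)
  where
  open ≤-Reasoning
  Σf = sumℚ (map f (allFin m))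
  Σh = sumℚ (map h (allFin m))

  sumℚ-with : ∀ (k : Fin m → ℚ) C c → sumℚ (map (λ i → k i + pointMass C c i) (allFin m)) ≡ sumℚ (map k (allFin m)) + c
  sumℚ-with k C c = trans (sumℚ-+ (allFin m) k (pointMass C c)) (cong (sumℚ (map k (allFin m)) +_) (sumℚ-pointMass C c))

  pointwise : ∀ i → f i + pointMass A a i ≤ℚ h i + pointMass B b i
  pointwise i with i ≟ A | i ≟ B
  ... | yes refl | _      rewrite pointMass-self A a | pointMass-other b A≢B | +-identityʳ (h A) = at-A
  ... | no i≢A   | yes refl rewrite pointMass-self B b | pointMass-other a i≢A | +-identityʳ (f B) = at-B
  ... | no i≢A   | no i≢B rewrite pointMass-other a i≢A | pointMass-other b i≢B
                               | +-identityʳ (f i) | +-identityʳ (h i) = elsewhere i i≢A i≢B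

p*[0+q]+p≡p*[1+q] : ∀ p q → p * (0ℚ + q) + p ≡ p * (1ℚ + q)
p*[0+q]+p≡p*[1+q] = solve 2 (λ p q → p :* (con 0ℚ :+ q) :+ p := p :* (con 1ℚ :+ q)) refl
  where open +-*-Solver

-- Optimal costs under a non-increasing stack-depth distribution

module Optimality {n : ℕ} (s : Dist (suc n)) (s≥0 : ∀ ζ i → 0ℚ ≤ℚ s ζ i)
                  (s-antitone : ∀ ζ (i j : Fin (suc n)) → toℕ i ≤ toℕ j → s ζ j ≤ℚ s ζ i) where

  J : ℕ → List (Fin (suc n)) → Vec Bool (suc n) → ℚ
  J = Jopt s

  minEvict : ℕ → List (Fin (suc n)) → Vec Bool (suc n) → ℚ
  minEvict k ζ v = minList (map (λ j → J k ζ (evict v j)) (candidates v))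

  -- Jopt s (suc k) ζ x unfolds to the sum of s ζ i * cost k ζ x i over all i.
  cost : ℕ → List (Fin (suc n)) → Vec Bool (suc n) → Fin (suc n) → ℚ
  cost k ζ x i = g x i + (if lookup x i then J k (ζ ∷ʳ i) (next x i) else minEvict k (ζ ∷ʳ i) (next x i))

  cost-hit : ∀ k ζ (x : Vec Bool (suc n)) i → lookup x i ≡ true →
             cost k ζ x i ≡ 0ℚ + J k (ζ ∷ʳ i) (true ∷ removeAt x i)
  cost-hit k ζ x i hit rewrite hit | next≡ x i = refl

  cost-miss : ∀ k ζ (x : Vec Bool (suc n)) i → lookup x i ≡ false →
              cost k ζ x i ≡ 1ℚ + minEvict k (ζ ∷ʳ i) (true ∷ removeAt x i)
  cost-miss k ζ x i miss rewrite miss | next≡ x i = refl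

  s*-mono-≤ : ∀ ζ i {p q} → p ≤ℚ q → s ζ i * p ≤ℚ s ζ i * q
  s*-mono-≤ ζ i = *-monoˡ-≤-nonNeg (s ζ i) {{nonNegative (s≥0 ζ i)}}

  minEvict-≤ : ∀ k ζ (R : Vec Bool n) {j} → lookup R j ≡ true →
               minEvict k ζ (true ∷ R) ≤ℚ J k ζ (true ∷ R [ j ]≔ false)
  minEvict-≤ k ζ R {j} hit = minList-≤ (candidates (true ∷ R)) _ (Evictable⇒∈candidates (true ∷ R) {suc j} ((λ ()) , hit))

  minEvict-glb : ∀ k ζ (R : Vec Bool n) {c j₀} → lookup R j₀ ≡ true →
                 (∀ j → lookup R j ≡ true → c ≤ℚ J k ζ (true ∷ R [ j ]≔ false)) → c ≤ℚ minEvict k ζ (true ∷ R)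
  minEvict-glb k ζ R {c} {j₀} hit₀ bound =
    minList-glb (candidates (true ∷ R)) _ (Evictable⇒∈candidates (true ∷ R) {suc j₀} ((λ ()) , hit₀)) bound′
    where
    bound′ : ∀ j → j ∈ candidates (true ∷ R) → c ≤ℚ J k ζ (evict (true ∷ R) j)
    bound′ j j∈ with ∈candidates⇒Evictable (true ∷ R) j∈
    bound′ zero    _ | 0≢0 , _ = contradiction refl 0≢0
    bound′ (suc j) _ | _ , hit = bound j hit

  Monotone : ℕ → Set
  Monotone k = ∀ ζ {a b : Vec Bool n} → CriticalPair a b → J k ζ (true ∷ a) ≤ℚ J k ζ (true ∷ b)

  module _ (k : ℕ) (monotone-k : Monotone k) where

    J≤minEvict : ∀ ζ {a b : Vec Bool n} → TailPair a b → J k ζ (true ∷ a) ≤ℚ minEvict k ζ (true ∷ b)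
    J≤minEvict ζ {a} {b} t = minEvict-glb k ζ b (proj₂ (TailPair-added t)) bound
      where
      bound : ∀ j → lookup b j ≡ true → J k ζ (true ∷ a) ≤ℚ J k ζ (true ∷ b [ j ]≔ false)
      bound j hit with TailPair-evict t j hit
      ... | inj₁ eq = ≤-reflexive (cong (λ v → J k ζ (true ∷ v)) (sym eq))
      ... | inj₂ c  = monotone-k ζ c

    minEvict-mono-≤ : ∀ ζ {a b : Vec Bool n} → CriticalPair a b → minEvict k ζ (true ∷ a) ≤ℚ minEvict k ζ (true ∷ b)
    minEvict-mono-≤ ζ {a} {b} c = minEvict-glb k ζ b (proj₂ (CriticalPair-lower c)) bound
      where
      bound : ∀ j → lookup b j ≡ true → minEvict k ζ (true ∷ a) ≤ℚ J k ζ (true ∷ b [ j ]≔ false)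
      bound j hit with CriticalPair-evict c j hit
      ... | inj₁ (j′ , hit′ , eq) = subst (λ v → minEvict k ζ (true ∷ a) ≤ℚ J k ζ (true ∷ v)) eq (minEvict-≤ k ζ a hit′)
      ... | inj₂ (hit′ , c′)      = ≤-trans (minEvict-≤ k ζ a hit′) (monotone-k ζ c′)

    minEvict-deepest : ∀ ζ {R : Vec Bool n} {l} → Deepest R l → minEvict k ζ (true ∷ R) ≡ J k ζ (true ∷ R [ l ]≔ false)
    minEvict-deepest ζ d = ≤-antisym (minEvict-≤ k ζ _ (Deepest-lookup d)) (J≤minEvict ζ (Deepest-TailPair d))

  monotone-step : ∀ k → Monotone k → Monotone (suc k)
  monotone-step k monotone-k ζ {a} {b} c =
    sumℚ-exchange (λ i → s ζ i * cost k ζ y i) (λ i → s ζ i * cost k ζ z i)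
                  A≢B (s-antitone ζ A B (<⇒≤ (upper<lower c′))) at-A at-B elsewhere
    where
    open ≤-Reasoning
    y z : Vec Bool (suc n)
    y = true ∷ a
    z = true ∷ b
    c′ : CriticalPair y z
    c′ = there c
    A B : Fin (suc n)
    A = upper c′
    B = lower c′

    A≢B : A ≢ B
    A≢B A≡B = <-irrefl (cong toℕ A≡B) (upper<lower c′)

    at-A : s ζ A * cost k ζ y A + s ζ A ≤ℚ s ζ A * cost k ζ z A
    at-A = begin
      s ζ A * cost k ζ y A + s ζ A
        ≡⟨ cong (λ t → s ζ A * t + s ζ A) (cost-hit k ζ y A (proj₁ (CriticalPair-upper c′))) ⟩
      s ζ A * (0ℚ + J k (ζ ∷ʳ A) (true ∷ removeAt y A)) + s ζ A
        ≡⟨ p*[0+q]+p≡p*[1+q] (s ζ A) (J k (ζ ∷ʳ A) (true ∷ removeAt y A)) ⟩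
      s ζ A * (1ℚ + J k (ζ ∷ʳ A) (true ∷ removeAt y A))
        ≤⟨ s*-mono-≤ ζ A (+-monoʳ-≤ 1ℚ (J≤minEvict k monotone-k (ζ ∷ʳ A) (CriticalPair-removeAt-upper c′))) ⟩
      s ζ A * (1ℚ + minEvict k (ζ ∷ʳ A) (true ∷ removeAt z A))
        ≡⟨ cong (s ζ A *_) (sym (cost-miss k ζ z A (proj₂ (CriticalPair-upper c′)))) ⟩
      s ζ A * cost k ζ z A
        ∎

    at-B : s ζ B * cost k ζ y B ≤ℚ s ζ B * cost k ζ z B + s ζ B
    at-B with CriticalPair-removeAt-lower c′
    ... | j , hit , evicted≡ = begin
      s ζ B * cost k ζ y B
        ≡⟨ cong (s ζ B *_) (cost-miss k ζ y B (proj₁ (CriticalPair-lower c′))) ⟩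
      s ζ B * (1ℚ + minEvict k (ζ ∷ʳ B) (true ∷ removeAt y B))
        ≤⟨ s*-mono-≤ ζ B (+-monoʳ-≤ 1ℚ (minEvict-≤ k (ζ ∷ʳ B) (removeAt y B) hit)) ⟩
      s ζ B * (1ℚ + J k (ζ ∷ʳ B) (true ∷ removeAt y B [ j ]≔ false))
        ≡⟨ cong (λ v → s ζ B * (1ℚ + J k (ζ ∷ʳ B) (true ∷ v))) evicted≡ ⟩
      s ζ B * (1ℚ + J k (ζ ∷ʳ B) (true ∷ removeAt z B))
        ≡⟨ sym (p*[0+q]+p≡p*[1+q] (s ζ B) (J k (ζ ∷ʳ B) (true ∷ removeAt z B))) ⟩
      s ζ B * (0ℚ + J k (ζ ∷ʳ B) (true ∷ removeAt z B)) + s ζ B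
        ≡⟨ cong (λ t → s ζ B * t + s ζ B) (sym (cost-hit k ζ z B (proj₂ (CriticalPair-lower c′)))) ⟩
      s ζ B * cost k ζ z B + s ζ B
        ∎

    elsewhere : ∀ i → i ≢ A → i ≢ B → s ζ i * cost k ζ y i ≤ℚ s ζ i * cost k ζ z i
    elsewhere i i≢A i≢B = s*-mono-≤ ζ i (cost-≤ (lookup y i) refl)
      where
      agree : lookup y i ≡ lookup z i
      agree = CriticalPair-agree c′ i≢A i≢B

      cost-≤ : ∀ h → lookup y i ≡ h → cost k ζ y i ≤ℚ cost k ζ z i
      cost-≤ true hit = subst₂ _≤ℚ_ (sym (cost-hit k ζ y i hit)) (sym (cost-hit k ζ z i (trans (sym agree) hit)))
        (+-monoʳ-≤ 0ℚ (monotone-k (ζ ∷ʳ i) (CriticalPair-removeAt c′ i agree)))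
      cost-≤ false miss = subst₂ _≤ℚ_ (sym (cost-miss k ζ y i miss)) (sym (cost-miss k ζ z i (trans (sym agree) miss)))
        (+-monoʳ-≤ 1ℚ (minEvict-mono-≤ k monotone-k (ζ ∷ʳ i) (CriticalPair-removeAt c′ i agree)))

  monotone : ∀ k → Monotone k
  monotone zero    ζ c = ≤-refl
  monotone (suc k)     = monotone-step k (monotone k)

  Jpol-LRU≡J : ∀ k ζ (x : Vec Bool (suc n)) → ∃[ p ] lookup x p ≡ true → Jpol' s LRU k ζ x ≡ J k ζ x
  Jpol-LRU≡J zero    ζ x _          = refl
  Jpol-LRU≡J (suc k) ζ x (p , hitₚ) = cong sumℚ (map-cong (λ i → cong (s ζ i *_) (cost-LRU i (lookup x i) refl)) (allFin (suc n)))
    where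
    open ≡-Reasoning
    cost-LRU : ∀ i h → lookup x i ≡ h →
               g x i + (if lookup x i then Jpol' s LRU k (ζ ∷ʳ i) (next x i)
                                      else Jpol' s LRU k (ζ ∷ʳ i) (evict (next x i) (LRU ζ x i)))
               ≡ cost k ζ x i
    cost-LRU i true hit rewrite hit | next≡ x i = cong (0ℚ +_) (Jpol-LRU≡J k (ζ ∷ʳ i) (true ∷ removeAt x i) (zero , refl))
    cost-LRU i false miss rewrite miss with removeAt-buffered x hitₚ miss
    ... | q , hit′ with Deepest-exists hit′
    ... | l , d = cong (1ℚ +_) (begin
      Jpol' s LRU k (ζ ∷ʳ i) (evict (next x i) (LRU ζ x i))
        ≡⟨ cong (λ v → Jpol' s LRU k (ζ ∷ʳ i) (evict v (LRU ζ x i))) (next≡ x i) ⟩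
      Jpol' s LRU k (ζ ∷ʳ i) (evict (true ∷ removeAt x i) (LRU ζ x i))
        ≡⟨ cong (λ j → Jpol' s LRU k (ζ ∷ʳ i) (evict (true ∷ removeAt x i) j)) (LRU-evicts-deepest ζ x i d) ⟩
      Jpol' s LRU k (ζ ∷ʳ i) (true ∷ removeAt x i [ l ]≔ false)
        ≡⟨ Jpol-LRU≡J k (ζ ∷ʳ i) _ (zero , refl) ⟩
      J k (ζ ∷ʳ i) (true ∷ removeAt x i [ l ]≔ false)
        ≡⟨ sym (minEvict-deepest k (monotone k) (ζ ∷ʳ i) d) ⟩
      minEvict k (ζ ∷ʳ i) (true ∷ removeAt x i)
        ≡⟨ cong (minEvict k (ζ ∷ʳ i)) (sym (next≡ x i)) ⟩
      minEvict k (ζ ∷ʳ i) (next x i)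
        ∎)

  J≤Jpol : ∀ {C} (π : Policy (suc n)) → ValidPolicy C π →
           ∀ k ζ (x : Vec Bool (suc n)) → count x ≡ C → J k ζ x ≤ℚ Jpol' s π k ζ x
  J≤Jpol π valid zero    ζ x _    = ≤-refl
  J≤Jpol {C} π valid (suc k) ζ x ∣x∣≡C = sumℚ-mono-≤ (allFin (suc n)) (λ i → s*-mono-≤ ζ i (cost-≤ i (lookup x i) refl))
    where
    cost-≤ : ∀ i h → lookup x i ≡ h →
             cost k ζ x i ≤ℚ g x i + (if lookup x i then Jpol' s π k (ζ ∷ʳ i) (next x i)
                                                    else Jpol' s π k (ζ ∷ʳ i) (evict (next x i) (π ζ x i)))
    cost-≤ i true hit rewrite hit =
      +-monoʳ-≤ 0ℚ (J≤Jpol π valid k (ζ ∷ʳ i) (next x i) (trans (count-next-hit x i hit) ∣x∣≡C))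
    cost-≤ i false miss rewrite miss with valid ζ x ∣x∣≡C i miss
    ... | evictable@(_ , hit) = +-monoʳ-≤ 1ℚ (≤-trans
      (minList-≤ (candidates (next x i)) _ (Evictable⇒∈candidates (next x i) evictable))
      (J≤Jpol π valid k (ζ ∷ʳ i) _ (suc-injective
        (trans (sym (count-evict (next x i) (π ζ x i) hit)) (trans (count-next-miss x i miss) (cong suc ∣x∣≡C))))))

theorem8 : (V C : ℕ) → 1 ≤ C → C ≤ V → (s : Dist V)
    → (∀ ζ i → 0ℚ ≤ℚ s ζ i)
    → (∀ ζ → sumℚ (map (s ζ) (allFin V)) ≡ 1ℚ)
    → (∀ ζ (i j : Fin V) → toℕ i ≤ toℕ j → s ζ j ≤ℚ s ζ i)
    → (∀ (L : ℕ) (ζ : List (Fin V)) → length ζ ≤ L → ∀ (y z : Vec Bool V) → count y ≡ C → y ≤c z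
         → Jstar s L ζ y ≤ℚ Jstar s L ζ z)
      × (∀ (L : ℕ) (ζ : List (Fin V)) → length ζ ≤ L → ∀ (x : Vec Bool V) → count x ≡ C
         → Jpol s LRU L ζ x ≡ Jstar s L ζ x
           × (∀ (π : Policy V) → ValidPolicy C π → Jpol s LRU L ζ x ≤ℚ Jpol s π L ζ x))
theorem8 zero    (suc _) _        ()
theorem8 (suc n) C       (s≤s _) _ s s≥0 _ s-antitone = critical-monotone , LRU-optimal
  where
  open Optimality s s≥0 s-antitone

  critical-monotone : ∀ L ζ → length ζ ≤ L → ∀ y z → count y ≡ C → y ≤c z → Jstar s L ζ y ≤ℚ Jstar s L ζ z
  critical-monotone L ζ _ y z _ (inj₁ refl) = ≤-refl
  critical-monotone L ζ _ y z _ (inj₂ y<z) with <c⇒CriticalPair y<z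
  ... | a , b , refl , refl , c = monotone (L ∸ length ζ) ζ c

  LRU-optimal : ∀ L ζ → length ζ ≤ L → ∀ x → count x ≡ C →
                Jpol s LRU L ζ x ≡ Jstar s L ζ x × (∀ π → ValidPolicy C π → Jpol s LRU L ζ x ≤ℚ Jpol s π L ζ x)
  LRU-optimal L ζ _ x ∣x∣≡C = LRU≡J , λ π valid → subst (_≤ℚ Jpol s π L ζ x) (sym LRU≡J) (J≤Jpol π valid k ζ x ∣x∣≡C)
    where
    k = L ∸ length ζ
    LRU≡J = Jpol-LRU≡J k ζ x (count≡suc⇒buffered x ∣x∣≡C)
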